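{- Let $k$ and $d$ be constants. In any $k$-out bipartite digraph with parts $\mathcal A$ and $\mathcal B$ both of size $\Theta(N)$, $d$ uniformly random nodes of $\mathcal B$ have pairwise disjoint in-neighbourhoods with probability $1-O(1/N)$; the same holds for $d$ uniformly random nodes of $\mathcal A$.
   Context: A $k$-out bipartite digraph on parts $\mathcal A,\mathcal B$ is a directed (multi)graph in which every node has exactly $k$ out-edges, each going to the opposite part. For a node $v$, $N^-(v)$ denotes its set of in-neighbours and $N^+(v)$ its set of out-neighbours. -}

module Defs where

open import Data.Nat using (ℕ; zero; suc)
open import Data.Fin using (Fin; _≟_)
open import Data.Fin.Properties using (all?; any?)
open import Data.Product using (Σ; ∃; ∃-syntax; _×_; _,_)
open import Data.List using (List; []; _∷_; map; concatMap; filter; length; allFin)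
open import Data.Vec.Functional using (Vector) renaming (_∷_ to _∷ᶠ_)
open import Data.Empty using (⊥)
open import Relation.Nullary using (¬_; Dec; yes; no)
open import Relation.Nullary.Decidable using (¬?; _×-dec_; _→-dec_)
open import Relation.Binary.PropositionalEquality using (_≡_; _≢_)

-- A k-out bipartite digraph (multigraph) with parts A = Fin nA, B = Fin nB:
-- every node has exactly k out-edges (an ordered list of k targets, repetitions
-- allowed) going to the opposite part.
record KOutBip (k nA nB : ℕ) : Set where
  field
    outA : Fin nA → Fin k → Fin nB
    outB : Fin nB → Fin k → Fin nA
open KOutBip public

InNbr : ∀ {k m n} → (Fin m → Fin k → Fin n) → Fin n → Fin m → Set
InNbr out v u = ∃[ i ] out u i ≡ v

inNbr? : ∀ {k m n} (out : Fin m → Fin k → Fin n) (v : Fin n) (u : Fin m) → Dec (InNbr out v u)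
inNbr? out v u = any? (λ i → out u i ≟ v)

PairwiseDisjointIn : ∀ {k m n d} → (Fin m → Fin k → Fin n) → (Fin d → Fin n) → Set
PairwiseDisjointIn {m = m} {d = d} out f =
  (i j : Fin d) → i ≢ j → (u : Fin m) → ¬ (InNbr out (f i) u × InNbr out (f j) u)

pairwiseDisjointIn? : ∀ {k m n d} (out : Fin m → Fin k → Fin n) (f : Fin d → Fin n) →
                      Dec (PairwiseDisjointIn out f)
pairwiseDisjointIn? out f =
  all? (λ i → all? (λ j → ¬? (i ≟ j) →-dec
    all? (λ u → ¬? (inNbr? out (f i) u ×-dec inNbr? out (f j) u))))

-- All n^d tuples (Fin d → Fin n): the sample space of d independent uniform nodes.
allTuples : (n d : ℕ) → List (Fin d → Fin n)
allTuples n zero    = (λ ()) ∷ []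
allTuples n (suc d) = concatMap (λ x → map (λ f → x ∷ᶠ f) (allTuples n d)) (allFin n)

-- Number of d-tuples of nodes of the "to" part whose in-neighbourhoods are NOT
-- pairwise disjoint.  Failure probability = badCount out d / n ^ d.
badCount : ∀ {k m n} → (Fin m → Fin k → Fin n) → (d : ℕ) → ℕ
badCount {n = n} out d = length (filter (λ f → ¬? (pairwiseDisjointIn? out f)) (allTuples n d))

-- Every node u has at most k distinct out-neighbours, so it is a
-- common in-neighbour of at most k² ordered pairs, and there are σ ≤ m k² ordered
-- pairs with a common in-neighbour.  A tuple x ∷ g is bad only if g is bad or x
-- shares an in-neighbour with some coordinate of g; the latter happens for at most
-- d nᵈ⁻¹ σ tuples, and induction on d gives n² · bad(d) ≤ d² σ nᵈ.  As m, n and N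
-- agree up to the factor c, this is bad(d) · N ≤ c³ d² k² nᵈ.
module Submission where

open import Defs
open import Data.Nat.Properties
  using (+-*-semiring; +-commutativeSemigroup; ≤-refl; ≤-reflexive; ≤-trans; m≤m+n; n≤0⇒n≡0;
         +-mono-≤; +-monoʳ-≤; *-mono-≤; *-monoˡ-≤; *-monoʳ-≤; *-cancelˡ-≤; *-zeroʳ; *-identityʳ; *-assoc;
         module ≤-Reasoning)
open import Algebra.Properties.CommutativeSemigroup +-commutativeSemigroup
  using () renaming (interchange to +-interchange)
open import Algebra.Properties.Semiring.Sum +-*-semiring
  using (sum-syntax; sum-cong-≗; sum-replicate-zero; ∑-comm; ∑-distrib-+; *-distribˡ-sum; *-distribʳ-sum)
open import Data.Bool.Base using (true; false; if_then_else_)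
open import Data.Fin using (Fin; zero; suc; _≟_)
open import Data.Fin.Properties using (any?)
open import Data.List using (List; []; _∷_; _++_; map; concatMap; filter; length; tabulate; allFin)
open import Data.List.Properties using (map-++; map-∘)
open import Data.Nat using (ℕ; zero; suc; _+_; _*_; _^_; _≤_; z≤n; s≤s)
open import Data.Nat.ListAction using () renaming (sum to sumˡ)
open import Data.Nat.ListAction.Properties using (sum-++)
open import Data.Nat.Solver using (module +-*-Solver)
open import Data.Product using (∃; ∃-syntax; _×_; _,_)
open import Data.Sum using (_⊎_; inj₁; inj₂)
open import Data.Vec.Functional using () renaming (_∷_ to _∷ᶠ_)
open import Function using (_∘_; id)
open import Level using (Level)
open import Relation.Binary.PropositionalEquality using (_≡_; refl; sym; trans; cong; cong₂; module ≡-Reasoning)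
open import Relation.Nullary using (¬_; Dec; yes; no; does; contradiction)
open import Relation.Nullary.Decidable using (¬?; _×-dec_)
open import Relation.Unary using (Decidable)
open +-*-Solver using (solve; _:=_; _:+_; _:*_; con)

private
  variable
    a p q r : Level
    A : Set a
    P : Set p
    Q : Set q
    R : Set r

-- Defined through `does`, so that 𝟙 (suc x ≟ suc y) reduces to 𝟙 (x ≟ y).
𝟙 : Dec P → ℕ
𝟙 P? = if does P? then 1 else 0

𝟙-⊎ : (P → Q ⊎ R) → (P? : Dec P) (Q? : Dec Q) (R? : Dec R) → 𝟙 P? ≤ 𝟙 Q? + 𝟙 R?
𝟙-⊎ P⇒Q⊎R (no _)  Q?      R?      = z≤n
𝟙-⊎ P⇒Q⊎R (yes _) (yes _) R?      = s≤s z≤n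
𝟙-⊎ P⇒Q⊎R (yes _) (no _)  (yes _) = ≤-refl
𝟙-⊎ P⇒Q⊎R (yes p) (no ¬q) (no ¬r) with P⇒Q⊎R p
... | inj₁ q = contradiction q ¬q
... | inj₂ r = contradiction r ¬r

𝟙-×-dec : (P? : Dec P) (Q? : Dec Q) → 𝟙 (P? ×-dec Q?) ≡ 𝟙 P? * 𝟙 Q?
𝟙-×-dec (yes _) (yes _) = refl
𝟙-×-dec (yes _) (no _)  = refl
𝟙-×-dec (no _)  Q?      = refl

∑-mono-≤ : ∀ {n} {f g : Fin n → ℕ} → (∀ i → f i ≤ g i) → ∑[ i < n ] f i ≤ ∑[ i < n ] g i
∑-mono-≤ {zero}  f≤g = z≤n
∑-mono-≤ {suc n} f≤g = +-mono-≤ (f≤g zero) (∑-mono-≤ (f≤g ∘ suc))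

∑-const : ∀ n c → ∑[ _ < n ] c ≡ n * c
∑-const zero    c = refl
∑-const (suc n) c = cong (c +_) (∑-const n c)

union-bound : ∀ {n} {P : Fin n → Set p} (P? : Decidable P) (∃P? : Dec (∃ P)) →
              𝟙 ∃P? ≤ ∑[ i < n ] 𝟙 (P? i)
union-bound {n = zero}  P? (no _)       = z≤n
union-bound {n = zero}  P? (yes (() , _))
union-bound {n = suc n} {P = P} P? ∃P? = begin
  𝟙 ∃P?                                   ≤⟨ 𝟙-⊎ split ∃P? (P? zero) ∃P?′ ⟩
  𝟙 (P? zero) + 𝟙 ∃P?′                    ≤⟨ +-monoʳ-≤ (𝟙 (P? zero)) (union-bound (P? ∘ suc) ∃P?′) ⟩
  𝟙 (P? zero) + ∑[ i < n ] 𝟙 (P? (suc i)) ∎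
  where
  open ≤-Reasoning
  ∃P?′ : Dec (∃ (P ∘ suc))
  ∃P?′ = any? (P? ∘ suc)
  split : ∃ P → P zero ⊎ ∃ (P ∘ suc)
  split (zero  , p) = inj₁ p
  split (suc i , p) = inj₂ (i , p)

∑-𝟙-≟ : ∀ {n} (c : Fin n) → ∑[ y < n ] 𝟙 (c ≟ y) ≡ 1
∑-𝟙-≟ {suc n} zero    = cong suc (sum-replicate-zero n)
∑-𝟙-≟ {suc n} (suc c) = ∑-𝟙-≟ c

∑-product : ∀ {a b c} (f : Fin a → Fin c → ℕ) (g : Fin b → Fin c → ℕ) →
            ∑[ i < a ] ∑[ j < b ] ∑[ u < c ] (f i u * g j u) ≡
            ∑[ u < c ] (∑[ i < a ] f i u * ∑[ j < b ] g j u)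
∑-product {a} {b} {c} f g = begin
  ∑[ i < a ] ∑[ j < b ] ∑[ u < c ] (f i u * g j u)  ≡⟨ sum-cong-≗ (λ i → ∑-comm (λ j u → f i u * g j u)) ⟩
  ∑[ i < a ] ∑[ u < c ] ∑[ j < b ] (f i u * g j u)  ≡⟨ sum-cong-≗ (λ i → sum-cong-≗ (λ u → sym (*-distribˡ-sum (f i u) (λ j → g j u)))) ⟩
  ∑[ i < a ] ∑[ u < c ] (f i u * ∑[ j < b ] g j u)  ≡⟨ ∑-comm (λ i u → f i u * ∑[ j < b ] g j u) ⟩
  ∑[ u < c ] ∑[ i < a ] (f i u * ∑[ j < b ] g j u)  ≡⟨ sum-cong-≗ (λ u → sym (*-distribʳ-sum (∑[ j < b ] g j u) (λ i → f i u))) ⟩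
  ∑[ u < c ] (∑[ i < a ] f i u * ∑[ j < b ] g j u) ∎
  where open ≡-Reasoning

∑∈ : List A → (A → ℕ) → ℕ
∑∈ xs f = sumˡ (map f xs)

infixl 10 ∑∈
syntax ∑∈ xs (λ x → e) = ∑[ x ∈ xs ] e

∑∈-mono-≤ : ∀ (xs : List A) {f g : A → ℕ} → (∀ x → f x ≤ g x) → ∑[ x ∈ xs ] f x ≤ ∑[ x ∈ xs ] g x
∑∈-mono-≤ []       f≤g = z≤n
∑∈-mono-≤ (x ∷ xs) f≤g = +-mono-≤ (f≤g x) (∑∈-mono-≤ xs f≤g)

∑∈-distrib-+ : ∀ (xs : List A) (f g : A → ℕ) →
               ∑[ x ∈ xs ] (f x + g x) ≡ ∑[ x ∈ xs ] f x + ∑[ x ∈ xs ] g x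
∑∈-distrib-+ []       f g = refl
∑∈-distrib-+ (x ∷ xs) f g = begin
  f x + g x + ∑[ y ∈ xs ] (f y + g y)              ≡⟨ cong (f x + g x +_) (∑∈-distrib-+ xs f g) ⟩
  f x + g x + (∑[ y ∈ xs ] f y + ∑[ y ∈ xs ] g y)  ≡⟨ +-interchange (f x) (g x) _ _ ⟩
  f x + ∑[ y ∈ xs ] f y + (g x + ∑[ y ∈ xs ] g y)  ∎
  where open ≡-Reasoning

∑-∑∈-comm : ∀ {n} (xs : List A) (f : Fin n → A → ℕ) →
            ∑[ i < n ] ∑[ x ∈ xs ] f i x ≡ ∑[ x ∈ xs ] ∑[ i < n ] f i x
∑-∑∈-comm {n = n} []       f = sum-replicate-zero n
∑-∑∈-comm         (x ∷ xs) f = trans (∑-distrib-+ (λ i → f i x) _) (cong (_ +_) (∑-∑∈-comm xs f))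

∑∈-concatMap : ∀ {b} {B : Set b} (h : A → List B) (xs : List A) (f : B → ℕ) →
               ∑[ y ∈ concatMap h xs ] f y ≡ ∑[ x ∈ xs ] ∑[ y ∈ h x ] f y
∑∈-concatMap h []       f = refl
∑∈-concatMap h (x ∷ xs) f = begin
  sumˡ (map f (h x ++ concatMap h xs))              ≡⟨ cong sumˡ (map-++ f (h x) _) ⟩
  sumˡ (map f (h x) ++ map f (concatMap h xs))      ≡⟨ sum-++ (map f (h x)) _ ⟩
  ∑[ y ∈ h x ] f y + ∑[ y ∈ concatMap h xs ] f y   ≡⟨ cong (_ +_) (∑∈-concatMap h xs f) ⟩
  ∑[ y ∈ h x ] f y + ∑[ x′ ∈ xs ] ∑[ y ∈ h x′ ] f y ∎
  where open ≡-Reasoning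

∑∈-map : ∀ {b} {B : Set b} (g : A → B) (xs : List A) (f : B → ℕ) →
         ∑[ y ∈ map g xs ] f y ≡ ∑[ x ∈ xs ] f (g x)
∑∈-map g xs f = cong sumˡ (sym (map-∘ xs))

∑∈-tabulate : ∀ {n} (g : Fin n → A) (f : A → ℕ) → ∑[ x ∈ tabulate g ] f x ≡ ∑[ i < n ] f (g i)
∑∈-tabulate {n = zero}  g f = refl
∑∈-tabulate {n = suc n} g f = cong (f (g zero) +_) (∑∈-tabulate (g ∘ suc) f)

length-filter≡∑𝟙 : ∀ {P : A → Set p} (P? : Decidable P) (xs : List A) →
                    length (filter P? xs) ≡ ∑[ x ∈ xs ] 𝟙 (P? x)
length-filter≡∑𝟙 P? []       = refl
length-filter≡∑𝟙 P? (x ∷ xs) with does (P? x)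
... | true  = cong suc (length-filter≡∑𝟙 P? xs)
... | false = length-filter≡∑𝟙 P? xs

∑-allTuples-suc : ∀ n d (F : (Fin (suc d) → Fin n) → ℕ) →
                  ∑[ g ∈ allTuples n (suc d) ] F g ≡ ∑[ y < n ] ∑[ h ∈ allTuples n d ] F (y ∷ᶠ h)
∑-allTuples-suc n d F = begin
  ∑[ g ∈ allTuples n (suc d) ] F g                     ≡⟨ ∑∈-concatMap (λ y → map (y ∷ᶠ_) T) (allFin n) F ⟩
  ∑[ y ∈ allFin n ] ∑[ g ∈ map (y ∷ᶠ_) T ] F g        ≡⟨ ∑∈-tabulate id (λ y → ∑[ g ∈ map (y ∷ᶠ_) T ] F g) ⟩
  ∑[ y < n ] ∑[ g ∈ map (y ∷ᶠ_) T ] F g               ≡⟨ sum-cong-≗ (λ y → ∑∈-map (y ∷ᶠ_) T F) ⟩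
  ∑[ y < n ] ∑[ h ∈ T ] F (y ∷ᶠ h)                    ∎
  where
  open ≡-Reasoning
  T : List (Fin d → Fin n)
  T = allTuples n d

∑-allTuples-const : ∀ n d c → ∑[ _ ∈ allTuples n d ] c ≡ n ^ d * c
∑-allTuples-const n zero    c = refl
∑-allTuples-const n (suc d) c = begin
  ∑[ _ ∈ allTuples n (suc d) ] c      ≡⟨ ∑-allTuples-suc n d (λ _ → c) ⟩
  ∑[ _ < n ] ∑[ _ ∈ allTuples n d ] c ≡⟨ sum-cong-≗ {n} (λ _ → ∑-allTuples-const n d c) ⟩
  ∑[ _ < n ] (n ^ d * c)              ≡⟨ ∑-const n (n ^ d * c) ⟩
  n * (n ^ d * c)                     ≡⟨ *-assoc n (n ^ d) c ⟨
  n ^ suc d * c                       ∎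
  where open ≡-Reasoning

-- Multiplied by n so that the count n ^ (d ∸ 1) of tuples with a fixed coordinate never appears.
∑-coordinates : ∀ n d (w : Fin n → ℕ) →
                n * ∑[ g ∈ allTuples n d ] ∑[ j < d ] w (g j) ≡ d * n ^ d * ∑[ y < n ] w y
∑-coordinates n zero    w = *-zeroʳ n
∑-coordinates n (suc d) w = begin
  n * ∑[ g ∈ allTuples n (suc d) ] ∑[ j < suc d ] w (g j)   ≡⟨ cong (n *_) (∑-allTuples-suc n d _) ⟩
  n * ∑[ y < n ] ∑[ h ∈ T ] (w y + S h)                     ≡⟨ cong (n *_) (sum-cong-≗ λ y →
                                                                 trans (∑∈-distrib-+ T (λ _ → w y) S)
                                                                       (cong (_+ ∑[ h ∈ T ] S h) (∑-allTuples-const n d (w y)))) ⟩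
  n * ∑[ y < n ] (n ^ d * w y + ∑[ h ∈ T ] S h)             ≡⟨ cong (n *_) (∑-distrib-+ (λ y → n ^ d * w y) _) ⟩
  n * (∑[ y < n ] (n ^ d * w y) + ∑[ _ < n ] ∑[ h ∈ T ] S h) ≡⟨ cong (n *_) (cong₂ _+_ (sym (*-distribˡ-sum (n ^ d) w))
                                                                                     (∑-const n (∑[ h ∈ T ] S h))) ⟩
  n * (n ^ d * W + n * ∑[ h ∈ T ] S h)                      ≡⟨ cong (λ t → n * (n ^ d * W + t)) (∑-coordinates n d w) ⟩
  n * (n ^ d * W + d * n ^ d * W)                           ≡⟨ solve 4 (λ n p d W → n :* (p :* W :+ d :* p :* W)
                                                                 := (con 1 :+ d) :* (n :* p) :* W) refl n (n ^ d) d W ⟩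
  suc d * n ^ suc d * W                                     ∎
  where
  open ≡-Reasoning
  T : List (Fin d → Fin n)
  T = allTuples n d
  S : (Fin d → Fin n) → ℕ
  S h = ∑[ j < d ] w (h j)
  W : ℕ
  W = ∑[ y < n ] w y

module InNeighbourhoods {k m n : ℕ} (out : Fin m → Fin k → Fin n) where

  SharesInNbr : Fin n → Fin n → Set
  SharesInNbr x y = ∃[ u ] (InNbr out x u × InNbr out y u)

  sharesInNbr? : ∀ x y → Dec (SharesInNbr x y)
  sharesInNbr? x y = any? (λ u → inNbr? out x u ×-dec inNbr? out y u)

  sharingPairs : ℕ
  sharingPairs = ∑[ x < n ] ∑[ y < n ] 𝟙 (sharesInNbr? x y)

  outNbrs≤k : ∀ u → ∑[ y < n ] 𝟙 (inNbr? out y u) ≤ k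
  outNbrs≤k u = begin
    ∑[ y < n ] 𝟙 (inNbr? out y u)          ≤⟨ ∑-mono-≤ (λ y → union-bound (λ i → out u i ≟ y) (inNbr? out y u)) ⟩
    ∑[ y < n ] ∑[ i < k ] 𝟙 (out u i ≟ y)  ≡⟨ ∑-comm (λ y i → 𝟙 (out u i ≟ y)) ⟩
    ∑[ i < k ] ∑[ y < n ] 𝟙 (out u i ≟ y)  ≡⟨ sum-cong-≗ (λ i → ∑-𝟙-≟ (out u i)) ⟩
    ∑[ _ < k ] 1                           ≡⟨ trans (∑-const k 1) (*-identityʳ k) ⟩
    k                                      ∎
    where open ≤-Reasoning

  sharingPairs≤ : sharingPairs ≤ m * (k * k)
  sharingPairs≤ = begin
    sharingPairs                                          ≤⟨ ∑-mono-≤ (λ x → ∑-mono-≤ (λ y → viaCommonInNbr x y)) ⟩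
    ∑[ x < n ] ∑[ y < n ] ∑[ u < m ] (arc x u * arc y u)  ≡⟨ ∑-product arc arc ⟩
    ∑[ u < m ] (∑[ x < n ] arc x u * ∑[ y < n ] arc y u)  ≤⟨ ∑-mono-≤ (λ u → *-mono-≤ (outNbrs≤k u) (outNbrs≤k u)) ⟩
    ∑[ _ < m ] (k * k)                                    ≡⟨ ∑-const m (k * k) ⟩
    m * (k * k)                                           ∎
    where
    open ≤-Reasoning
    arc : Fin n → Fin m → ℕ
    arc x u = 𝟙 (inNbr? out x u)
    viaCommonInNbr : ∀ x y → 𝟙 (sharesInNbr? x y) ≤ ∑[ u < m ] (arc x u * arc y u)
    viaCommonInNbr x y = ≤-trans (union-bound (λ u → inNbr? out x u ×-dec inNbr? out y u) (sharesInNbr? x y))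
                                 (≤-reflexive (sum-cong-≗ (λ u → 𝟙-×-dec (inNbr? out x u) (inNbr? out y u))))

  Bad : ∀ {d} → (Fin d → Fin n) → Set
  Bad g = ¬ PairwiseDisjointIn out g

  bad? : ∀ {d} (g : Fin d → Fin n) → Dec (Bad g)
  bad? g = ¬? (pairwiseDisjointIn? out g)

  Hits : ∀ {d} → Fin n → (Fin d → Fin n) → Set
  Hits x g = ∃[ j ] SharesInNbr (g j) x

  hits? : ∀ {d} (x : Fin n) (g : Fin d → Fin n) → Dec (Hits x g)
  hits? x g = any? (λ j → sharesInNbr? (g j) x)

  bad-∷ : ∀ {d} x (g : Fin d → Fin n) → Bad (x ∷ᶠ g) → Bad g ⊎ Hits x g
  bad-∷ x g bad with hits? x g | pairwiseDisjointIn? out g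
  ... | yes hit | _        = inj₂ hit
  ... | no _    | no bad-g = inj₁ bad-g
  ... | no miss | yes disj = contradiction disj′ bad
    where
    disj′ : PairwiseDisjointIn out (x ∷ᶠ g)
    disj′ zero    zero    0≢0 u _       = 0≢0 refl
    disj′ zero    (suc j) _   u (p , q) = miss (j , u , q , p)
    disj′ (suc i) zero    _   u (p , q) = miss (i , u , p , q)
    disj′ (suc i) (suc j) i≢j u pq      = disj i j (i≢j ∘ cong suc) u pq

  badTuples : ℕ → ℕ
  badTuples d = ∑[ g ∈ allTuples n d ] 𝟙 (bad? g)

  hittingPairs : ℕ → ℕ
  hittingPairs d = ∑[ x < n ] ∑[ g ∈ allTuples n d ] 𝟙 (hits? x g)

  badTuples-suc : ∀ d → badTuples (suc d) ≤ n * badTuples d + hittingPairs d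
  badTuples-suc d = begin
    badTuples (suc d)                                              ≡⟨ ∑-allTuples-suc n d (𝟙 ∘ bad?) ⟩
    ∑[ y < n ] ∑[ h ∈ T ] 𝟙 (bad? (y ∷ᶠ h))                        ≤⟨ ∑-mono-≤ (λ y → ∑∈-mono-≤ T (λ h →
                                                                        𝟙-⊎ (bad-∷ y h) (bad? (y ∷ᶠ h)) (bad? h) (hits? y h))) ⟩
    ∑[ y < n ] ∑[ h ∈ T ] (𝟙 (bad? h) + 𝟙 (hits? y h))             ≡⟨ sum-cong-≗ (λ y → ∑∈-distrib-+ T (𝟙 ∘ bad?) (𝟙 ∘ hits? y)) ⟩
    ∑[ y < n ] (badTuples d + ∑[ h ∈ T ] 𝟙 (hits? y h))            ≡⟨ ∑-distrib-+ (λ _ → badTuples d) (λ y → ∑[ h ∈ T ] 𝟙 (hits? y h)) ⟩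
    ∑[ _ < n ] badTuples d + hittingPairs d                        ≡⟨ cong (_+ hittingPairs d) (∑-const n (badTuples d)) ⟩
    n * badTuples d + hittingPairs d                               ∎
    where
    open ≤-Reasoning
    T : List (Fin d → Fin n)
    T = allTuples n d

  hittingPairs≤ : ∀ d → n * hittingPairs d ≤ d * n ^ d * sharingPairs
  hittingPairs≤ d = begin
    n * ∑[ x < n ] ∑[ g ∈ T ] 𝟙 (hits? x g)                    ≡⟨ cong (n *_) (∑-∑∈-comm T (λ x g → 𝟙 (hits? x g))) ⟩
    n * ∑[ g ∈ T ] ∑[ x < n ] 𝟙 (hits? x g)                    ≤⟨ *-monoʳ-≤ n (∑∈-mono-≤ T hitsViaCoordinates) ⟩
    n * ∑[ g ∈ T ] ∑[ j < d ] ∑[ x < n ] 𝟙 (sharesInNbr? (g j) x) ≡⟨ ∑-coordinates n d (λ y → ∑[ x < n ] 𝟙 (sharesInNbr? y x)) ⟩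
    d * n ^ d * sharingPairs                                   ∎
    where
    open ≤-Reasoning
    T : List (Fin d → Fin n)
    T = allTuples n d
    hitsViaCoordinates : ∀ g → ∑[ x < n ] 𝟙 (hits? x g) ≤ ∑[ j < d ] ∑[ x < n ] 𝟙 (sharesInNbr? (g j) x)
    hitsViaCoordinates g = ≤-trans (∑-mono-≤ (λ x → union-bound (λ j → sharesInNbr? (g j) x) (hits? x g)))
                                   (≤-reflexive (∑-comm (λ x j → 𝟙 (sharesInNbr? (g j) x))))

  badTuples≤ : ∀ d → n * (n * badTuples d) ≤ d * d * (n ^ d * sharingPairs)
  badTuples≤ zero    = ≤-reflexive (trans (cong (n *_) (*-zeroʳ n)) (*-zeroʳ n))
  badTuples≤ (suc d) = begin
    n * (n * badTuples (suc d))                              ≤⟨ *-monoʳ-≤ n (*-monoʳ-≤ n (badTuples-suc d)) ⟩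
    n * (n * (n * badTuples d + hittingPairs d))             ≡⟨ solve 3 (λ n B H → n :* (n :* (n :* B :+ H))
                                                                  := n :* (n :* (n :* B)) :+ n :* (n :* H)) refl n (badTuples d) (hittingPairs d) ⟩
    n * (n * (n * badTuples d)) + n * (n * hittingPairs d)   ≤⟨ +-mono-≤ (*-monoʳ-≤ n (badTuples≤ d)) (*-monoʳ-≤ n (hittingPairs≤ d)) ⟩
    n * (d * d * (n ^ d * σ)) + n * (d * n ^ d * σ)          ≤⟨ m≤m+n _ (suc d * (n * n ^ d * σ)) ⟩
    n * (d * d * (n ^ d * σ)) + n * (d * n ^ d * σ) + suc d * (n * n ^ d * σ)
                                                             ≡⟨ solve 4 (λ n p σ d → n :* (d :* d :* (p :* σ)) :+ n :* (d :* p :* σ) :+ (con 1 :+ d) :* (n :* p :* σ)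
                                                                  := (con 1 :+ d) :* (con 1 :+ d) :* (n :* p :* σ)) refl n (n ^ d) σ d ⟩
    suc d * suc d * (n ^ suc d * σ)                          ∎
    where
    open ≤-Reasoning
    σ : ℕ
    σ = sharingPairs

  badCount≤ : ∀ d → n * (n * badCount out d) ≤ m * (d * d * (k * k) * n ^ d)
  badCount≤ d = begin
    n * (n * badCount out d)             ≡⟨ cong (λ b → n * (n * b)) (length-filter≡∑𝟙 bad? (allTuples n d)) ⟩
    n * (n * badTuples d)                ≤⟨ badTuples≤ d ⟩
    d * d * (n ^ d * sharingPairs)       ≤⟨ *-monoʳ-≤ (d * d) (*-monoʳ-≤ (n ^ d) sharingPairs≤) ⟩
    d * d * (n ^ d * (m * (k * k)))      ≡⟨ solve 4 (λ d p m k → d :* d :* (p :* (m :* (k :* k))) := m :* (d :* d :* (k :* k) :* p)) refl d (n ^ d) m k ⟩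
    m * (d * d * (k * k) * n ^ d)        ∎
    where open ≤-Reasoning

rescale : ∀ {b m N} n c K P → n * (n * b) ≤ m * (K * P) → m ≤ c * N → N ≤ c * n →
          b * N ≤ c * c * c * K * P
rescale {b} zero c K P _ _ N≤0 rewrite n≤0⇒n≡0 (≤-trans N≤0 (≤-reflexive (*-zeroʳ c))) | *-zeroʳ b = z≤n
rescale {b} {m} {N} n@(suc _) c K P nnb≤mKP m≤cN N≤cn = begin
  b * N                    ≤⟨ *-monoʳ-≤ b N≤cn ⟩
  b * (c * n)              ≡⟨ solve 3 (λ b c n → b :* (c :* n) := c :* (n :* b)) refl b c n ⟩
  c * (n * b)              ≤⟨ *-monoʳ-≤ c nb≤ccKP ⟩
  c * (c * c * (K * P))    ≡⟨ solve 3 (λ c K P → c :* (c :* c :* (K :* P)) := c :* c :* c :* K :* P) refl c K P ⟩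
  c * c * c * K * P        ∎
  where
  open ≤-Reasoning
  nb≤ccKP : n * b ≤ c * c * (K * P)
  nb≤ccKP = *-cancelˡ-≤ n (begin
    n * (n * b)            ≤⟨ nnb≤mKP ⟩
    m * (K * P)            ≤⟨ *-monoˡ-≤ (K * P) (≤-trans m≤cN (*-monoʳ-≤ c N≤cn)) ⟩
    c * (c * n) * (K * P)  ≡⟨ solve 4 (λ c n K P → c :* (c :* n) :* (K :* P) := n :* (c :* c :* (K :* P))) refl c n K P ⟩
    n * (c * c * (K * P))  ∎)

mainTheorem7 : (k d c : ℕ) →
    ∃[ C ] ((N nA nB : ℕ) →
      nA ≤ c * N → N ≤ c * nA → nB ≤ c * N → N ≤ c * nB →
      (G : KOutBip k nA nB) →
      (badCount (outA G) d * N ≤ C * nB ^ d) × (badCount (outB G) d * N ≤ C * nA ^ d))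
mainTheorem7 k d c = c * c * c * K , λ N nA nB nA≤cN N≤cnA nB≤cN N≤cnB G →
    rescale nB c K (nB ^ d) (InNeighbourhoods.badCount≤ (outA G) d) nA≤cN N≤cnB
  , rescale nA c K (nA ^ d) (InNeighbourhoods.badCount≤ (outB G) d) nB≤cN N≤cnA
  where
  K : ℕ
  K = d * d * (k * k)
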